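{- Let $\mathcal{G}$ be a simple temporal clique on $n$ vertices, and let the collectors be defined as below (for any of the arbitrary choices allowed in the construction). Then the number of collectors is at most $n/2$.
   Context: A simple temporal clique is a pair $\mathcal{G}=(G,\lambda)$ where $G=(V,E)$ is the complete graph on a finite vertex set $V$ with $n=|V|\ge 2$, and $\lambda:E\to\mathbb{N}$ assigns each edge a single label such that any two distinct edges sharing an endpoint have distinct labels. For a vertex $v$, $e^+(v)$ denotes the edge incident to $v$ with the largest label. Let $E^+$ be the set of arcs on $V$ containing, for each vertex $v$ with $e^+(v)=\{u,v\}$, the arc $(v,u)$, except that whenever $e^+(u)=e^+(v)$ only one of $(u,v),(v,u)$ is included (chosen arbitrarily). A source of $E^+$ is a vertex of in-degree $0$ in $(V,E^+)$. Let $E^+_T$ be obtained from $E^+$ as follows: for every vertex $v$ of in-degree at least $2$ in $E^+$, let $(u_1,v),\dots,(u_\ell,v)$ be its in-arcs where $(u_\ell,v)$ has the smallest label; for each $i<\ell$, if $u_i$ is a source of $E^+$ replace $(u_i,v)$ by $(v,u_i)$, otherwise delete $(u_i,v)$. The collectors are the vertices of in-degree $0$ in $(V,E^+_T)$. -}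

module Defs where

open import Data.Nat using (ℕ; _≤_; _<_)
open import Data.Fin using (Fin)
open import Data.Product using (_×_; ∃)
open import Data.Sum using (_⊎_)
open import Relation.Nullary using (¬_)
open import Relation.Binary.PropositionalEquality using (_≡_; _≢_)

-- A labelling of the complete graph on Fin n: lab u v is the label of edge {u,v}
-- (values on the diagonal are irrelevant and never used).
Labelling : ℕ → Set
Labelling n = Fin n → Fin n → ℕ

record IsSimpleTemporalClique {n : ℕ} (lab : Labelling n) : Set where
  field
    symmetric : ∀ u v → u ≢ v → lab u v ≡ lab v u
    locInj    : ∀ u v w → u ≢ v → u ≢ w → v ≢ w → lab u v ≢ lab u w

-- e⁺(v) = {v,u}: u ≠ v and the edge {v,u} has the largest label among edges at v.
IsTop : ∀ {n} → Labelling n → Fin n → Fin n → Set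
IsTop lab v u = (u ≢ v) × (∀ w → w ≢ v → lab v w ≤ lab v u)

-- A (arc relation on Fin n) is a valid choice of E⁺:
--  every arc (v,u) has e⁺(v) = {v,u}; if e⁺(v) = {v,u} and e⁺(u) ≠ e⁺(v) then (v,u) ∈ E⁺;
--  if e⁺(u) = e⁺(v) = {u,v} then exactly one of (u,v), (v,u) is in E⁺.
record IsEPlus {n : ℕ} (lab : Labelling n) (A : Fin n → Fin n → Set) : Set where
  field
    arc⇒top   : ∀ v u → A v u → IsTop lab v u
    single    : ∀ v u → IsTop lab v u → ¬ IsTop lab u v → A v u
    mutualSome : ∀ v u → IsTop lab v u → IsTop lab u v → A v u ⊎ A u v
    mutualOne  : ∀ v u → IsTop lab v u → IsTop lab u v → ¬ (A v u × A u v)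

Source : ∀ {n} → (Fin n → Fin n → Set) → Fin n → Set
Source A v = ∀ u → ¬ A u v

-- Arcs of E⁺_T (all replacements/deletions performed simultaneously from E⁺):
--  (x,y) ∈ E⁺_T iff
--   (kept)     (x,y) ∈ E⁺ and it has the smallest label among the in-arcs of y in E⁺
--              (this covers in-degree 1, and the arc (u_ℓ,y) when in-degree ≥ 2), or
--   (reversed) (y,x) ∈ E⁺ is a non-minimal in-arc of x (some in-arc (w,x) has a
--              smaller label, so x has in-degree ≥ 2) and its tail y is a source of E⁺;
--              it is replaced by (x,y).
data ETArc {n : ℕ} (lab : Labelling n) (A : Fin n → Fin n → Set) : Fin n → Fin n → Set where
  kept     : ∀ {x y} → A x y → (∀ w → A w y → lab x y ≤ lab w y) → ETArc lab A x y
  reversed : ∀ {x y} → A y x → Source A y → (∃ λ w → A w x × lab w x < lab y x)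
           → ETArc lab A x y

Collector : ∀ {n} → Labelling n → (Fin n → Fin n → Set) → Fin n → Set
Collector lab A v = ∀ x → ¬ ETArc lab A x v

-- A collector v has no in-arc in E⁺, since an in-arc of minimal label would survive in E⁺_T.
-- Hence its top edge e⁺(v) = {v,u} is an arc (v,u) of E⁺, and this arc must be the in-arc of
-- u of minimal label, for otherwise it would be reversed into v. So u survives with an in-arc
-- and is not a collector, and by local injectivity of the labels at u no other collector can
-- send its top edge to u. Thus v ↦ u maps the collectors injectively into the non-collectors.
module Submission where

open import Defs
open import Data.Nat using (ℕ; _≤_; _*_)
open import Data.Fin using (Fin)
open import Data.Fin.Subset using (Subset; _∈_; ∣_∣)

open import Data.Nat using (suc; _<_; _+_; s≤s; z≤n)
open import Data.Nat.Properties using (≤-refl; ≤-antisym; <-≤-trans; ≮⇒≥; +-identityʳ)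
open import Data.Fin using (punchIn; punchOut) renaming (zero to fzero; suc to fsuc)
open import Data.Fin.Properties using (punchInᵢ≢i; punchIn-punchOut; suc-injective; injective⇒≤; +↔⊎; _≟_)
open import Data.Fin.Subset using (inside; outside; _∉_)
open import Data.List using (allFin)
open import Data.List.Extrema.Nat using (argmax; f[xs]≤f[argmax])
open import Data.List.Membership.Propositional.Properties using (∈-allFin)
import Data.List.Relation.Unary.All as All
open import Data.Vec using (_∷_; here; there)
open import Data.Product using (∃; _,_; proj₁; proj₂)
open import Data.Sum using (_⊎_; inj₁; inj₂; [_,_]′)
open import Data.Empty using (⊥-elim)
open import Function using (_∘_; Injection)
open import Function.Properties.Inverse using (↔⇒↣)
open import Relation.Nullary using (¬_)
open import Relation.Nullary.Decidable using (decidable-stable)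
open import Relation.Binary.PropositionalEquality using (_≡_; _≢_; refl; sym; trans; cong; subst)

maximum-attained : ∀ {m} (f : Fin (suc m) → ℕ) → ∃ λ i → ∀ j → f j ≤ f i
maximum-attained f =
  argmax f fzero (allFin _) , λ j → All.lookup (f[xs]≤f[argmax] {f = f} fzero (allFin _)) (∈-allFin j)

enumerate : ∀ {n} (p : Subset n) → Fin ∣ p ∣ → Fin n
enumerate (inside  ∷ p) fzero    = fzero
enumerate (inside  ∷ p) (fsuc i) = fsuc (enumerate p i)
enumerate (outside ∷ p) i        = fsuc (enumerate p i)

enumerate-∈ : ∀ {n} (p : Subset n) i → enumerate p i ∈ p
enumerate-∈ (inside  ∷ p) fzero    = here
enumerate-∈ (inside  ∷ p) (fsuc i) = there (enumerate-∈ p i)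
enumerate-∈ (outside ∷ p) i        = there (enumerate-∈ p i)

enumerate-injective : ∀ {n} (p : Subset n) {i j} → enumerate p i ≡ enumerate p j → i ≡ j
enumerate-injective (inside  ∷ p) {fzero}  {fzero}  _ = refl
enumerate-injective (inside  ∷ p) {fzero}  {fsuc j} ()
enumerate-injective (inside  ∷ p) {fsuc i} {fzero}  ()
enumerate-injective (inside  ∷ p) {fsuc i} {fsuc j} e = cong fsuc (enumerate-injective p (suc-injective e))
enumerate-injective (outside ∷ p) e = enumerate-injective p (suc-injective e)

injection-into-∁⇒∣p∣+∣p∣≤n : ∀ {n} (p : Subset n) (f : Fin n → Fin n)
  → (∀ {x} → x ∈ p → f x ∉ p)
  → (∀ {x y} → x ∈ p → y ∈ p → f x ≡ f y → x ≡ y)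
  → ∣ p ∣ + ∣ p ∣ ≤ n
injection-into-∁⇒∣p∣+∣p∣≤n {n} p f f∉p f-inj =
  injective⇒≤ (λ e → Injection.injective (↔⇒↣ +↔⊎) (both-injective _ _ e))
  where
  both : Fin ∣ p ∣ ⊎ Fin ∣ p ∣ → Fin n
  both = [ enumerate p , f ∘ enumerate p ]′

  both-injective : ∀ a b → both a ≡ both b → a ≡ b
  both-injective (inj₁ i) (inj₁ j) e = cong inj₁ (enumerate-injective p e)
  both-injective (inj₁ i) (inj₂ j) e = ⊥-elim (f∉p (enumerate-∈ p j) (subst (_∈ p) e (enumerate-∈ p i)))
  both-injective (inj₂ i) (inj₁ j) e = ⊥-elim (f∉p (enumerate-∈ p i) (subst (_∈ p) (sym e) (enumerate-∈ p j)))
  both-injective (inj₂ i) (inj₂ j) e =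
    cong inj₂ (enumerate-injective p (f-inj (enumerate-∈ p i) (enumerate-∈ p j) e))

top-exists : ∀ {k} (lab : Labelling (suc (suc k))) v → ∃ (IsTop lab v)
top-exists lab v with maximum-attained (lab v ∘ punchIn v)
... | i , i-max = punchIn v i , punchInᵢ≢i v i , λ w w≢v →
  subst (λ x → lab v x ≤ lab v (punchIn v i)) (punchIn-punchOut (w≢v ∘ sym)) (i-max (punchOut (w≢v ∘ sym)))

module _ {n} {lab : Labelling n} {A : Fin n → Fin n → Set} where

  collector⇒source : ∀ {v} → Collector lab A v → Source A v
  collector⇒source {v} col x x→v = no-in-arc-below (suc (lab x v)) x ≤-refl x→v
    where
    no-in-arc-below : ∀ m x → lab x v < m → ¬ A x v
    no-in-arc-below (suc m) x (s≤s lx≤m) x→v = col x (kept x→v minimal)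
      where
      minimal : ∀ w → A w v → lab x v ≤ lab w v
      minimal w w→v = ≮⇒≥ λ lw<lx → no-in-arc-below m w (<-≤-trans lw<lx lx≤m) w→v

  -- Otherwise the arc (v,u) would be reversed into v, as v is a source.
  collector-arc-minimal : ∀ {v u} → Collector lab A v → A v u → ∀ w → A w u → lab v u ≤ lab w u
  collector-arc-minimal col v→u w w→u =
    ≮⇒≥ λ lw<lv → col _ (reversed v→u (collector⇒source col) (w , w→u , lw<lv))

  collector-arc-kept : ∀ {v u} → Collector lab A v → A v u → ETArc lab A v u
  collector-arc-kept col v→u = kept v→u (collector-arc-minimal col v→u)

  source-top⇒¬¬arc : IsEPlus lab A → ∀ {v u} → Source A v → IsTop lab v u → ¬ ¬ A v u
  source-top⇒¬¬arc ep {v} {u} src top ¬v→u = ¬¬mutual mutual⇒⊥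
    where
    open IsEPlus ep

    ¬¬mutual : ¬ ¬ IsTop lab u v
    ¬¬mutual ¬top = ¬v→u (single v u top ¬top)

    mutual⇒⊥ : ¬ IsTop lab u v
    mutual⇒⊥ top′ = [ ¬v→u , src u ]′ (mutualSome v u top top′)

  incident-labels-injective : IsSimpleTemporalClique lab → ∀ {u v w}
    → u ≢ v → u ≢ w → lab v u ≡ lab w u → v ≡ w
  incident-labels-injective cl {u} {v} {w} u≢v u≢w e =
    decidable-stable (v ≟ w) λ v≢w →
      locInj u v w u≢v u≢w v≢w (trans (symmetric u v u≢v) (trans e (sym (symmetric u w u≢w))))
    where open IsSimpleTemporalClique cl

  module _ (ep : IsEPlus lab A) {S : Subset n} (col : ∀ v → v ∈ S → Collector lab A v) where

    collector-top⇒¬¬arc : ∀ {v u} → IsTop lab v u → v ∈ S → ¬ ¬ A v u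
    collector-top⇒¬¬arc top v∈S = source-top⇒¬¬arc ep (collector⇒source (col _ v∈S)) top

    top-of-collector-∉ : ∀ {v u} → IsTop lab v u → v ∈ S → u ∉ S
    top-of-collector-∉ {v} {u} top v∈S u∈S =
      collector-top⇒¬¬arc top v∈S λ v→u →
        col u u∈S v (collector-arc-kept (col v v∈S) v→u)

    top-of-collector-injective : IsSimpleTemporalClique lab → ∀ {v w u}
      → IsTop lab v u → IsTop lab w u → v ∈ S → w ∈ S → v ≡ w
    top-of-collector-injective cl {v} {w} top-v top-w v∈S w∈S =
      decidable-stable (v ≟ w) λ v≢w →
        collector-top⇒¬¬arc top-v v∈S λ v→u → collector-top⇒¬¬arc top-w w∈S λ w→u →
          v≢w (incident-labels-injective cl (proj₁ top-v) (proj₁ top-w)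
                 (≤-antisym (collector-arc-minimal (col v v∈S) v→u w w→u)
                            (collector-arc-minimal (col w w∈S) w→u v v→u)))

lemma5 : (n : ℕ) → 2 ≤ n → (lab : Labelling n) → IsSimpleTemporalClique lab
    → (A : Fin n → Fin n → Set) → IsEPlus lab A
    → (S : Subset n) → (∀ v → v ∈ S → Collector lab A v)
    → 2 * ∣ S ∣ ≤ n
lemma5 (suc (suc k)) (s≤s (s≤s z≤n)) lab cl A ep S col rewrite +-identityʳ ∣ S ∣ =
  injection-into-∁⇒∣p∣+∣p∣≤n S top (top-of-collector-∉ ep col (top-is-top _)) top-injective
  where
  top : Fin (suc (suc k)) → Fin (suc (suc k))
  top v = proj₁ (top-exists lab v)

  top-is-top : ∀ v → IsTop lab v (top v)
  top-is-top v = proj₂ (top-exists lab v)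

  top-injective : ∀ {v w} → v ∈ S → w ∈ S → top v ≡ top w → v ≡ w
  top-injective {v} {w} v∈S w∈S e = top-of-collector-injective ep col cl
    (top-is-top v) (subst (IsTop lab w) (sym e) (top-is-top w)) v∈S w∈S
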